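{- $\mathbf G_{\mathsf{FL}_{\mathsf{ei}}}(\mathsf{BA})$ is the subvariety of $\mathsf{FL}_{\mathsf{ei}}$ axiomatized by $\neg x\wedge\neg(x\to y)\leq 0$, and $\mathbf G_{\mathsf{FL}_{\mathsf{ew}}}(\mathsf{BA})$ is the subvariety of $\mathsf{FL}_{\mathsf{ew}}$ axiomatized by $x\wedge\neg x\leq 0$.
   Context: An FL${}_{\mathrm e}$-algebra is an algebra $\langle A,\wedge,\vee,\cdot,\to,0,1\rangle$ such that $\langle A,\wedge,\vee\rangle$ is a lattice (with order $\leq$), $\langle A,\cdot,1\rangle$ is a commutative monoid, $0$ is an arbitrary constant, and $x\cdot y\leq z \iff x\leq y\to z$. It is integral if $1$ is the greatest element, and satisfies weakening if it is integral and $0$ is the least element. Write $\neg x:=x\to 0$. $\mathsf{FL}_{\mathsf e}$, $\mathsf{FL}_{\mathsf{ei}}$, $\mathsf{FL}_{\mathsf{ew}}$ denote the varieties of all, integral, and weakening FL${}_{\mathrm e}$-algebras respectively. $\mathsf{BA}$ denotes the variety of Boolean algebras viewed as FL${}_{\mathrm e}$-algebras satisfying $x\cdot y=x\wedge y$ and $x\to y=\neg x\vee y$. $\mathbf G_{\mathsf{FL}_{\mathsf e}}(\mathsf{BA})$ is the largest subvariety $\mathsf W$ of $\mathsf{FL}_{\mathsf e}$ such that for every equation $s\approx t$, $\mathsf{BA}\models s\approx t$ iff $\mathsf W\models\neg s\approx\neg t$; and for a subvariety $\mathsf U$, $\mathbf G_{\mathsf U}(\mathsf{BA}):=\mathbf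 G_{\mathsf{FL}_{\mathsf e}}(\mathsf{BA})\cap\mathsf U$. -}

module Defs where

open import Data.Nat using (ℕ)
open import Data.Product using (Σ; _×_; _,_; proj₁; proj₂)
open import Function.Bundles using (_⇔_)
open import Relation.Binary.PropositionalEquality using (_≡_)
open import Algebra.Lattice.Structures using (IsLattice)
open import Algebra.Structures using (IsCommutativeMonoid)
open import Level using (Level) renaming (suc to lsuc; zero to lzero)

record FLe : Set₁ where
  infixr 7 _∧_
  infixr 6 _∨_
  infixl 8 _·_
  infixr 5 _⇒_
  field
    Carrier : Set
    _∧_ _∨_ _·_ _⇒_ : Carrier → Carrier → Carrier
    𝟘 𝟙 : Carrier
    isLattice : IsLattice _≡_ _∨_ _∧_
    isCommutativeMonoid : IsCommutativeMonoid _≡_ _·_ 𝟙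

  _≤_ : Carrier → Carrier → Set
  x ≤ y = (x ∧ y) ≡ x

  field
    residuation : ∀ x y z → ((x · y) ≤ z) ⇔ (x ≤ (y ⇒ z))

  ¬_ : Carrier → Carrier
  ¬ x = x ⇒ 𝟘

Integral : FLe → Set
Integral A = ∀ x → x ≤ 𝟙  where open FLe A

Weakening : FLe → Set
Weakening A = Integral A × (∀ x → 𝟘 ≤ x)  where open FLe A

data Term : Set where
  var : ℕ → Term
  _∧ₜ_ _∨ₜ_ _·ₜ_ _⇒ₜ_ : Term → Term → Term
  0ₜ 1ₜ : Term

¬ₜ_ : Term → Term
¬ₜ t = t ⇒ₜ 0ₜ

Equation : Set
Equation = Term × Term

_≤ₑ_ : Term → Term → Equation
s ≤ₑ t = (s ∧ₜ t , s)

eval : (A : FLe) → (ℕ → FLe.Carrier A) → Term → FLe.Carrier A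
eval A ρ (var n) = ρ n
eval A ρ (s ∧ₜ t) = FLe._∧_ A (eval A ρ s) (eval A ρ t)
eval A ρ (s ∨ₜ t) = FLe._∨_ A (eval A ρ s) (eval A ρ t)
eval A ρ (s ·ₜ t) = FLe._·_ A (eval A ρ s) (eval A ρ t)
eval A ρ (s ⇒ₜ t) = FLe._⇒_ A (eval A ρ s) (eval A ρ t)
eval A ρ 0ₜ = FLe.𝟘 A
eval A ρ 1ₜ = FLe.𝟙 A

_⊨_ : FLe → Equation → Set
A ⊨ (s , t) = ∀ (ρ : ℕ → FLe.Carrier A) → eval A ρ s ≡ eval A ρ t

-- Subvarieties of FLe, presented (Birkhoff) as equational classes:
-- a set of equations Γ determines the subvariety Mod Γ of FLe.

EqSet : Set₁
EqSet = Equation → Set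

Mod : EqSet → FLe → Set
Mod Γ A = ∀ e → Γ e → A ⊨ e

_⊨ᵛ_ : (FLe → Set) → Equation → Set₁
W ⊨ᵛ e = ∀ (B : FLe) → W B → B ⊨ e

BA : FLe → Set
BA A = (∀ x y → (x · y) ≡ (x ∧ y)) × (∀ x y → (x ⇒ y) ≡ ((¬ x) ∨ y))
  where open FLe A

GlivenkoBA : (FLe → Set) → Set₁
GlivenkoBA W = ∀ (s t : Term) → (BA ⊨ᵛ (s , t)) ⇔ (W ⊨ᵛ (¬ₜ s , ¬ₜ t))

-- Membership in G_FLe(BA), the largest subvariety with the Glivenko
-- property: A lies in some subvariety of FLe with the Glivenko property.
InG : FLe → Set₁
InG A = Σ EqSet (λ Γ → GlivenkoBA (Mod Γ) × Mod Γ A)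

axiomEi : Equation
axiomEi = ((¬ₜ var 0) ∧ₜ (¬ₜ (var 0 ⇒ₜ var 1))) ≤ₑ 0ₜ

axiomEw : Equation
axiomEw = (var 0 ∧ₜ (¬ₜ var 0)) ≤ₑ 0ₜ

-- In an integral FLe-algebra with ¬x ∧ ¬(x → y) ≤ 0 we get x ∧ ¬x ≤ 0, hence x · y ≤ 0 iff
-- x ∧ y ≤ 0 and ¬(x · y) = ¬(x ∧ y). Consequently the regular elements ¬¬x form a Boolean
-- algebra whose product is the meet, and x ↦ ¬¬x is a homomorphism onto it; a Boolean
-- identity s ≈ t therefore gives ¬¬s = ¬¬t, i.e. ¬s = ¬t. Boolean algebras satisfy the
-- axiom and have ¬¬x = x, which gives the converse implication. Finally, if a variety has the
-- Glivenko property, the Boolean identity s ≈ 0 for the left-hand side s of the axiom gives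
-- ¬s = ¬0 = 1, i.e. s ≤ 0. Under weakening, x ∧ ¬x ≤ 0 implies the first axiom because
-- ¬(x → y) ≤ ¬(x → 0).
module Submission where

open import Defs
open import Data.Nat using (ℕ; zero; suc)
open import Data.Product using (_×_; _,_; proj₁; proj₂; Σ)
open import Data.List using ([]; _∷_)
open import Data.List.Membership.Propositional using (_∈_)
open import Data.List.Relation.Unary.All using (All; []; _∷_; lookup)
open import Data.List.Relation.Unary.Any using (here; there)
open import Function.Bundles using (_⇔_; mk⇔; Equivalence)
open import Relation.Binary.PropositionalEquality
open import Axiom.UniquenessOfIdentityProofs.WithK using (uip)
open import Algebra.Lattice.Structures using (IsLattice)
open import Algebra.Lattice.Bundles using (Lattice)
open import Algebra.Structures using (IsCommutativeMonoid)
open import Algebra.Lattice.Properties.Lattice using (∨-∧-orderTheoreticLattice)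
import Relation.Binary.Lattice as OrderTheoretic
open import Relation.Binary.Bundles using (Poset)
import Relation.Binary.Reasoning.PartialOrder as PosetReasoning

module FLeProperties (A : FLe) where
  open FLe A public renaming (_≤_ to infix 4 _≤_; ¬_ to infix 9 ¬_)
  open IsLattice isLattice public using (∧-comm; ∧-assoc; ∨-comm; ∨-assoc; ∨-absorbs-∧)
  open IsCommutativeMonoid isCommutativeMonoid public
    using ()
    renaming (assoc to ·-assoc; comm to ·-comm; identityˡ to ·-identityˡ; identityʳ to ·-identityʳ)

  -- The library orders a lattice by x ≈ x ∧ y, the converse equation of _≤_.
  private
    lattice : Lattice _ _
    lattice = record { isLattice = isLattice }
    module L = OrderTheoretic.Lattice (∨-∧-orderTheoreticLattice lattice)

  ≤-refl : ∀ {x} → x ≤ x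
  ≤-refl = sym L.refl

  ≤-trans : ∀ {x y z} → x ≤ y → y ≤ z → x ≤ z
  ≤-trans p q = sym (L.trans (sym p) (sym q))

  ≤-antisym : ∀ {x y} → x ≤ y → y ≤ x → x ≡ y
  ≤-antisym p q = L.antisym (sym p) (sym q)

  ≤-poset : Poset _ _ _
  ≤-poset = record
    { _≈_ = _≡_
    ; _≤_ = _≤_
    ; isPartialOrder = record
      { isPreorder = record
        { isEquivalence = isEquivalence
        ; reflexive = λ { refl → ≤-refl }
        ; trans = ≤-trans
        }
      ; antisym = ≤-antisym
      }
    }

  module ≤-Reasoning = PosetReasoning ≤-poset

  x∧y≤x : ∀ {x y} → x ∧ y ≤ x
  x∧y≤x = sym (L.x∧y≤x _ _)

  x∧y≤y : ∀ {x y} → x ∧ y ≤ y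
  x∧y≤y = sym (L.x∧y≤y _ _)

  ∧-greatest : ∀ {x y z} → x ≤ y → x ≤ z → x ≤ y ∧ z
  ∧-greatest p q = sym (L.∧-greatest (sym p) (sym q))

  ∧-mono : ∀ {x x′ y y′} → x ≤ x′ → y ≤ y′ → x ∧ y ≤ x′ ∧ y′
  ∧-mono p q = ∧-greatest (≤-trans x∧y≤x p) (≤-trans x∧y≤y q)

  x≤x∨y : ∀ {x y} → x ≤ x ∨ y
  x≤x∨y = sym (L.x≤x∨y _ _)

  y≤x∨y : ∀ {x y} → y ≤ x ∨ y
  y≤x∨y = sym (L.y≤x∨y _ _)

  ∨-least : ∀ {x y z} → x ≤ z → y ≤ z → x ∨ y ≤ z
  ∨-least p q = sym (L.∨-least (sym p) (sym q))

  ⇒-intro : ∀ {x y z} → x · y ≤ z → x ≤ y ⇒ z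
  ⇒-intro {x} {y} {z} = Equivalence.to (residuation x y z)

  ⇒-elim : ∀ {x y z} → x ≤ y ⇒ z → x · y ≤ z
  ⇒-elim {x} {y} {z} = Equivalence.from (residuation x y z)

  modus-ponens : ∀ {x y} → (x ⇒ y) · x ≤ y
  modus-ponens = ⇒-elim ≤-refl

  ·-comm-≤ : ∀ {x y z} → x · y ≤ z → y · x ≤ z
  ·-comm-≤ {x} {y} {z} = subst (_≤ z) (·-comm x y)

  ·-monoˡ : ∀ {x y z} → x ≤ y → x · z ≤ y · z
  ·-monoˡ p = ⇒-elim (≤-trans p (⇒-intro ≤-refl))

  ·-monoʳ : ∀ {x y z} → y ≤ z → x · y ≤ x · z
  ·-monoʳ {x} {y} {z} p = subst₂ _≤_ (·-comm y x) (·-comm z x) (·-monoˡ p)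

  ⇒-monoʳ : ∀ {x y y′} → y ≤ y′ → x ⇒ y ≤ x ⇒ y′
  ⇒-monoʳ p = ⇒-intro (≤-trans modus-ponens p)

  𝟙⇒x≡x : ∀ {x} → 𝟙 ⇒ x ≡ x
  𝟙⇒x≡x {x} = ≤-antisym (subst (_≤ x) (·-identityʳ (𝟙 ⇒ x)) modus-ponens)
                         (⇒-intro (subst (_≤ x) (sym (·-identityʳ x)) ≤-refl))

  Regular : Carrier → Set
  Regular x = ¬ ¬ x ≡ x

  ¬-antitone : ∀ {x y} → x ≤ y → ¬ y ≤ ¬ x
  ¬-antitone p = ⇒-intro (≤-trans (·-monoʳ p) modus-ponens)

  ¬-swap : ∀ {x y} → x ≤ ¬ y → y ≤ ¬ x
  ¬-swap p = ⇒-intro (·-comm-≤ (⇒-elim p))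

  x≤¬¬x : ∀ {x} → x ≤ ¬ ¬ x
  x≤¬¬x = ¬-swap ≤-refl

  ¬¬-mono : ∀ {x y} → x ≤ y → ¬ ¬ x ≤ ¬ ¬ y
  ¬¬-mono p = ¬-antitone (¬-antitone p)

  ¬-regular : ∀ {x} → Regular (¬ x)
  ¬-regular = ≤-antisym (¬-antitone x≤¬¬x) x≤¬¬x

  ¬¬-least : ∀ {x y} → Regular y → x ≤ y → ¬ ¬ x ≤ y
  ¬¬-least {x} regular p = subst (¬ ¬ x ≤_) regular (¬¬-mono p)

  ¬-∨ : ∀ {x y} → ¬ (x ∨ y) ≡ ¬ x ∧ ¬ y
  ¬-∨ = ≤-antisym (∧-greatest (¬-antitone x≤x∨y) (¬-antitone y≤x∨y))
                  (¬-swap (∨-least (¬-swap x∧y≤x) (¬-swap x∧y≤y)))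

  ¬[¬¬x∨y]≡¬[x∨y] : ∀ {x y} → ¬ (¬ ¬ x ∨ y) ≡ ¬ (x ∨ y)
  ¬[¬¬x∨y]≡¬[x∨y] {x} {y} = begin
    ¬ (¬ ¬ x ∨ y)   ≡⟨ ¬-∨ ⟩
    ¬ ¬ ¬ x ∧ ¬ y   ≡⟨ cong (_∧ ¬ y) ¬-regular ⟩
    ¬ x ∧ ¬ y       ≡⟨ ¬-∨ ⟨
    ¬ (x ∨ y)       ∎
    where open ≡-Reasoning

  ¬[x∨¬¬y]≡¬[x∨y] : ∀ {x y} → ¬ (x ∨ ¬ ¬ y) ≡ ¬ (x ∨ y)
  ¬[x∨¬¬y]≡¬[x∨y] {x} {y} = begin
    ¬ (x ∨ ¬ ¬ y)   ≡⟨ cong ¬_ (∨-comm x (¬ ¬ y)) ⟩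
    ¬ (¬ ¬ y ∨ x)   ≡⟨ ¬[¬¬x∨y]≡¬[x∨y] ⟩
    ¬ (y ∨ x)       ≡⟨ cong ¬_ (∨-comm y x) ⟩
    ¬ (x ∨ y)       ∎
    where open ≡-Reasoning

  ¬𝟙≡𝟘 : ¬ 𝟙 ≡ 𝟘
  ¬𝟙≡𝟘 = 𝟙⇒x≡x

  𝟙≤¬𝟘 : 𝟙 ≤ ¬ 𝟘
  𝟙≤¬𝟘 = ⇒-intro (subst (_≤ 𝟘) (sym (·-identityˡ 𝟘)) ≤-refl)

  ¬x≡¬𝟘⇒x≤𝟘 : ∀ {x} → ¬ x ≡ ¬ 𝟘 → x ≤ 𝟘
  ¬x≡¬𝟘⇒x≤𝟘 {x} p =
    subst (_≤ 𝟘) (·-identityˡ x) (⇒-elim (subst (𝟙 ≤_) (sym p) 𝟙≤¬𝟘))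

  contrapose : ∀ {x y z} → x · y ≤ z → x · ¬ z ≤ ¬ y
  contrapose {x} {y} {z} p = ⇒-intro (subst (_≤ 𝟘) (·-rotate x y (¬ z))
                                              (≤-trans (·-monoˡ p) (·-comm-≤ modus-ponens)))
    where
    ·-rotate : ∀ a b c → (a · b) · c ≡ (a · c) · b
    ·-rotate a b c = trans (·-assoc a b c) (trans (cong (a ·_) (·-comm b c)) (sym (·-assoc a c b)))

  ¬¬-·-mono : ∀ {x y z} → x · y ≤ z → ¬ ¬ x · y ≤ ¬ ¬ z
  ¬¬-·-mono p = ·-comm-≤ (contrapose (contrapose (·-comm-≤ p)))

  ⇒-regular : ∀ {x y} → Regular y → Regular (x ⇒ y)
  ⇒-regular {x} {y} regular =
    ≤-antisym (⇒-intro (subst (¬ ¬ (x ⇒ y) · x ≤_) regular (¬¬-·-mono modus-ponens))) x≤¬¬x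

  ¬¬x·¬¬y≤¬¬[x·y] : ∀ {x y} → ¬ ¬ x · ¬ ¬ y ≤ ¬ ¬ (x · y)
  ¬¬x·¬¬y≤¬¬[x·y] {x} {y} = ·-comm-≤ (subst (¬ ¬ y · ¬ ¬ x ≤_) (cong ¬_ ¬-regular)
                                        (¬¬-·-mono (·-comm-≤ (¬¬-·-mono ≤-refl))))

  x⇒y≤¬¬x⇒¬¬y : ∀ {x y} → x ⇒ y ≤ ¬ ¬ x ⇒ ¬ ¬ y
  x⇒y≤¬¬x⇒¬¬y = ⇒-intro (·-comm-≤ (¬¬-·-mono (·-comm-≤ modus-ponens)))

module IntegralProperties (A : FLe) (integral : Integral A) where
  open FLeProperties A

  x·y≤x : ∀ {x y} → x · y ≤ x
  x·y≤x {x} {y} = subst (x · y ≤_) (·-identityʳ x) (·-monoʳ (integral y))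

  x·y≤x∧y : ∀ {x y} → x · y ≤ x ∧ y
  x·y≤x∧y = ∧-greatest x·y≤x (·-comm-≤ x·y≤x)

  𝟘≤¬x : ∀ {x} → 𝟘 ≤ ¬ x
  𝟘≤¬x = ⇒-intro x·y≤x

  ¬𝟘≡𝟙 : ¬ 𝟘 ≡ 𝟙
  ¬𝟘≡𝟙 = ≤-antisym (integral _) 𝟙≤¬𝟘

  𝟘-regular : Regular 𝟘
  𝟘-regular = trans (cong ¬_ ¬𝟘≡𝟙) ¬𝟙≡𝟘

  𝟙-regular : Regular 𝟙
  𝟙-regular = trans (cong ¬_ ¬𝟙≡𝟘) ¬𝟘≡𝟙

valuation₂ : {X : Set} → X → X → ℕ → X
valuation₂ x y zero    = x
valuation₂ x y (suc _) = y

module DoubleNegation (A : FLe) (integral : Integral A) (axiom : A ⊨ axiomEi) where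
  open FLeProperties A
  open IntegralProperties A integral

  ¬x∧¬[x⇒y]≤𝟘 : ∀ x y → ¬ x ∧ ¬ (x ⇒ y) ≤ 𝟘
  ¬x∧¬[x⇒y]≤𝟘 x y = axiom (valuation₂ x y)

  x∧¬x≤𝟘 : ∀ {x} → x ∧ ¬ x ≤ 𝟘
  x∧¬x≤𝟘 {x} = ≤-trans (∧-greatest x∧y≤y (≤-trans x∧y≤x x≤¬¬x)) (¬x∧¬[x⇒y]≤𝟘 x 𝟘)

  ·≤𝟘⇒∧≤𝟘 : ∀ {x y} → x · y ≤ 𝟘 → x ∧ y ≤ 𝟘
  ·≤𝟘⇒∧≤𝟘 p = ≤-trans (∧-greatest x∧y≤y (≤-trans x∧y≤x (⇒-intro p))) x∧¬x≤𝟘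

  ∧≤𝟘⇒·≤𝟘 : ∀ {x y} → x ∧ y ≤ 𝟘 → x · y ≤ 𝟘
  ∧≤𝟘⇒·≤𝟘 = ≤-trans x·y≤x∧y

  ¬[x·y]≡¬[x∧y] : ∀ {x y} → ¬ (x · y) ≡ ¬ (x ∧ y)
  ¬[x·y]≡¬[x∧y] {x} {y} =
    ≤-antisym (⇒-intro (≤-trans z·[x∧y]≤z·x∧y (·≤𝟘⇒∧≤𝟘 [z·x]·y≤𝟘))) (¬-antitone x·y≤x∧y)
    where
    z = ¬ (x · y)
    [z·x]·y≤𝟘 : (z · x) · y ≤ 𝟘
    [z·x]·y≤𝟘 = subst (_≤ 𝟘) (sym (·-assoc z x y)) modus-ponens
    z·[x∧y]≤z·x∧y : z · (x ∧ y) ≤ (z · x) ∧ y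
    z·[x∧y]≤z·x∧y = ∧-greatest (·-monoʳ x∧y≤x) (≤-trans (·-comm-≤ x·y≤x) x∧y≤y)

  ⇒-elim-∧ : ∀ {x y z} → Regular z → x ≤ y ⇒ z → x ∧ y ≤ z
  ⇒-elim-∧ {x} {y} {z} regular p =
    subst (x ∧ y ≤_) regular
          (≤-trans x≤¬¬x (¬-antitone (subst (¬ z ≤_) ¬[x·y]≡¬[x∧y] (¬-antitone (⇒-elim p)))))

  ¬¬-∧ : ∀ {x y} → ¬ ¬ (x ∧ y) ≡ ¬ ¬ x ∧ ¬ ¬ y
  ¬¬-∧ {x} {y} = ≤-antisym (∧-greatest (¬¬-mono x∧y≤x) (¬¬-mono x∧y≤y)) ¬¬x∧¬¬y≤¬¬[x∧y]
    where
    ¬¬x∧¬¬y≤¬¬[x∧y] : ¬ ¬ x ∧ ¬ ¬ y ≤ ¬ ¬ (x ∧ y)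
    ¬¬x∧¬¬y≤¬¬[x∧y] = subst (¬ ¬ x ∧ ¬ ¬ y ≤_) (cong ¬_ ¬[x·y]≡¬[x∧y])
                            (⇒-elim-∧ ¬-regular (⇒-intro ¬¬x·¬¬y≤¬¬[x·y]))

  ¬¬-· : ∀ {x y} → ¬ ¬ (x · y) ≡ ¬ ¬ x ∧ ¬ ¬ y
  ¬¬-· = trans (cong ¬_ ¬[x·y]≡¬[x∧y]) ¬¬-∧

  -- With u = ¬¬x ⇒ ¬¬y and n = ¬(x ⇒ y): the axiom gives n ≤ ¬¬x, and u ∧ ¬¬x ≤ ¬¬y ≤ ¬n.
  ¬¬x⇒¬¬y≤¬¬[x⇒y] : ∀ {x y} → ¬ ¬ x ⇒ ¬ ¬ y ≤ ¬ ¬ (x ⇒ y)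
  ¬¬x⇒¬¬y≤¬¬[x⇒y] {x} {y} = ⇒-intro (∧≤𝟘⇒·≤𝟘 (begin
    u ∧ n                   ≤⟨ ∧-mono ≤-refl (∧-greatest n≤¬¬x n≤¬y) ⟩
    u ∧ (¬ ¬ x ∧ ¬ y)       ≡⟨ ∧-assoc u (¬ ¬ x) (¬ y) ⟨
    (u ∧ ¬ ¬ x) ∧ ¬ y       ≤⟨ ∧-mono (⇒-elim-∧ ¬-regular ≤-refl) ≤-refl ⟩
    ¬ ¬ y ∧ ¬ y             ≤⟨ ∧-mono ≤-refl x≤¬¬x ⟩
    ¬ ¬ y ∧ ¬ ¬ ¬ y         ≤⟨ x∧¬x≤𝟘 ⟩
    𝟘                       ∎))
    where
    u = ¬ ¬ x ⇒ ¬ ¬ y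
    n = ¬ (x ⇒ y)
    n≤¬¬x : n ≤ ¬ ¬ x
    n≤¬¬x = ⇒-intro (∧≤𝟘⇒·≤𝟘 (subst (_≤ 𝟘) (∧-comm (¬ x) n) (¬x∧¬[x⇒y]≤𝟘 x y)))
    n≤¬y : n ≤ ¬ y
    n≤¬y = ¬-antitone (⇒-intro x·y≤x)
    open ≤-Reasoning

  ¬¬-⇒ : ∀ {x y} → ¬ ¬ (x ⇒ y) ≡ ¬ ¬ x ⇒ ¬ ¬ y
  ¬¬-⇒ = ≤-antisym (¬¬-least (⇒-regular ¬-regular) x⇒y≤¬¬x⇒¬¬y) ¬¬x⇒¬¬y≤¬¬[x⇒y]

  ⇒-boolean : ∀ {x y} → Regular x → Regular y → x ⇒ y ≡ ¬ ¬ (¬ x ∨ y)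
  ⇒-boolean {x} {y} x-regular y-regular = ≤-antisym ⇒≤ ≤⇒
    where
    ≤⇒ : ¬ ¬ (¬ x ∨ y) ≤ x ⇒ y
    ≤⇒ = ¬¬-least (⇒-regular y-regular)
                  (∨-least (⇒-monoʳ (subst (𝟘 ≤_) y-regular 𝟘≤¬x)) (⇒-intro x·y≤x))
    n = ¬ (¬ x ∨ y)
    n≤x∧¬y : n ≤ x ∧ ¬ y
    n≤x∧¬y = subst₂ _≤_ (sym ¬-∨) (cong (_∧ ¬ y) x-regular) ≤-refl
    ⇒≤ : x ⇒ y ≤ ¬ ¬ (¬ x ∨ y)
    ⇒≤ = ⇒-intro (∧≤𝟘⇒·≤𝟘 (begin
      (x ⇒ y) ∧ n               ≤⟨ ∧-mono ≤-refl n≤x∧¬y ⟩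
      (x ⇒ y) ∧ (x ∧ ¬ y)       ≡⟨ ∧-assoc (x ⇒ y) x (¬ y) ⟨
      ((x ⇒ y) ∧ x) ∧ ¬ y       ≤⟨ ∧-mono (⇒-elim-∧ y-regular ≤-refl) ≤-refl ⟩
      y ∧ ¬ y                   ≤⟨ x∧¬x≤𝟘 ⟩
      𝟘                         ∎))
      where open ≤-Reasoning

  Reg : Set
  Reg = Σ Carrier Regular

  Reg-≡ : {a b : Reg} → proj₁ a ≡ proj₁ b → a ≡ b
  Reg-≡ {x , p} {.x , q} refl = cong (x ,_) (uip p q)

  ¬¬ᴿ : Carrier → Reg
  ¬¬ᴿ x = ¬ ¬ x , ¬-regular

  infixr 7 _∧ᴿ_
  infixr 6 _∨ᴿ_
  infixr 5 _⇒ᴿ_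

  _∧ᴿ_ _∨ᴿ_ _⇒ᴿ_ : Reg → Reg → Reg
  (x , p) ∧ᴿ (y , q) = x ∧ y , trans ¬¬-∧ (cong₂ _∧_ p q)
  (x , _) ∨ᴿ (y , _) = ¬¬ᴿ (x ∨ y)
  (x , _) ⇒ᴿ (y , q) = x ⇒ y , ⇒-regular q

  𝟘ᴿ 𝟙ᴿ : Reg
  𝟘ᴿ = 𝟘 , 𝟘-regular
  𝟙ᴿ = 𝟙 , 𝟙-regular

  ∨ᴿ-assoc : ∀ a b c → (a ∨ᴿ b) ∨ᴿ c ≡ a ∨ᴿ (b ∨ᴿ c)
  ∨ᴿ-assoc (x , _) (y , _) (z , _) = Reg-≡ (cong ¬_ (begin
    ¬ (¬ ¬ (x ∨ y) ∨ z)   ≡⟨ ¬[¬¬x∨y]≡¬[x∨y] ⟩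
    ¬ ((x ∨ y) ∨ z)       ≡⟨ cong ¬_ (∨-assoc x y z) ⟩
    ¬ (x ∨ (y ∨ z))       ≡⟨ ¬[x∨¬¬y]≡¬[x∨y] ⟨
    ¬ (x ∨ ¬ ¬ (y ∨ z))   ∎))
    where open ≡-Reasoning

  ∧ᴿ-∨ᴿ-isLattice : IsLattice _≡_ _∨ᴿ_ _∧ᴿ_
  ∧ᴿ-∨ᴿ-isLattice = record
    { isEquivalence = isEquivalence
    ; ∨-comm = λ a b → Reg-≡ (cong (λ w → ¬ ¬ w) (∨-comm (proj₁ a) (proj₁ b)))
    ; ∨-assoc = ∨ᴿ-assoc
    ; ∨-cong = cong₂ _∨ᴿ_
    ; ∧-comm = λ a b → Reg-≡ (∧-comm (proj₁ a) (proj₁ b))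
    ; ∧-assoc = λ a b c → Reg-≡ (∧-assoc (proj₁ a) (proj₁ b) (proj₁ c))
    ; ∧-cong = cong₂ _∧ᴿ_
    ; absorptive = (λ a b → Reg-≡ (trans (cong (λ w → ¬ ¬ w) (∨-absorbs-∧ (proj₁ a) (proj₁ b)))
                                         (proj₂ a)))
                 , (λ a b → Reg-≡ (≤-trans x≤x∨y x≤¬¬x))
    }

  ∧ᴿ-𝟙ᴿ-isCommutativeMonoid : IsCommutativeMonoid _≡_ _∧ᴿ_ 𝟙ᴿ
  ∧ᴿ-𝟙ᴿ-isCommutativeMonoid = record
    { isMonoid = record
      { isSemigroup = record
        { isMagma = record { isEquivalence = isEquivalence ; ∙-cong = cong₂ _∧ᴿ_ }
        ; assoc = λ a b c → Reg-≡ (∧-assoc (proj₁ a) (proj₁ b) (proj₁ c))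
        }
      ; identity = (λ a → Reg-≡ (trans (∧-comm 𝟙 (proj₁ a)) (integral (proj₁ a))))
                 , (λ a → Reg-≡ (integral (proj₁ a)))
      }
    ; comm = λ a b → Reg-≡ (∧-comm (proj₁ a) (proj₁ b))
    }

  regularAlgebra : FLe
  regularAlgebra = record
    { Carrier = Reg
    ; _∧_ = _∧ᴿ_ ; _∨_ = _∨ᴿ_ ; _·_ = _∧ᴿ_ ; _⇒_ = _⇒ᴿ_
    ; 𝟘 = 𝟘ᴿ ; 𝟙 = 𝟙ᴿ
    ; isLattice = ∧ᴿ-∨ᴿ-isLattice
    ; isCommutativeMonoid = ∧ᴿ-𝟙ᴿ-isCommutativeMonoid
    ; residuation = λ a b c → mk⇔
        (λ a∧b≤c → Reg-≡ (⇒-intro (≤-trans x·y≤x∧y (cong proj₁ a∧b≤c))))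
        (λ a≤b⇒c → Reg-≡ (⇒-elim-∧ (proj₂ c) (cong proj₁ a≤b⇒c)))
    }

  regularAlgebra-isBA : BA regularAlgebra
  regularAlgebra-isBA = (λ _ _ → refl) , (λ a b → Reg-≡ (⇒-boolean (proj₂ a) (proj₂ b)))

  eval-¬¬ : ∀ ρ t → eval regularAlgebra (λ n → ¬¬ᴿ (ρ n)) t ≡ ¬¬ᴿ (eval A ρ t)
  eval-¬¬ ρ (var n)  = refl
  eval-¬¬ ρ (s ∧ₜ t) = trans (cong₂ _∧ᴿ_ (eval-¬¬ ρ s) (eval-¬¬ ρ t)) (Reg-≡ (sym ¬¬-∧))
  eval-¬¬ ρ (s ∨ₜ t) = trans (cong₂ _∨ᴿ_ (eval-¬¬ ρ s) (eval-¬¬ ρ t))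
                             (Reg-≡ (cong ¬_ (trans ¬[¬¬x∨y]≡¬[x∨y] ¬[x∨¬¬y]≡¬[x∨y])))
  eval-¬¬ ρ (s ·ₜ t) = trans (cong₂ _∧ᴿ_ (eval-¬¬ ρ s) (eval-¬¬ ρ t)) (Reg-≡ (sym ¬¬-·))
  eval-¬¬ ρ (s ⇒ₜ t) = trans (cong₂ _⇒ᴿ_ (eval-¬¬ ρ s) (eval-¬¬ ρ t)) (Reg-≡ (sym ¬¬-⇒))
  eval-¬¬ ρ 0ₜ       = Reg-≡ (sym 𝟘-regular)
  eval-¬¬ ρ 1ₜ       = Reg-≡ (sym 𝟙-regular)

  ¬-preserves-BA-equations : ∀ s t → BA ⊨ᵛ (s , t) → A ⊨ (¬ₜ s , ¬ₜ t)
  ¬-preserves-BA-equations s t valid ρ = begin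
    ¬ eval A ρ s                                 ≡⟨ ¬-regular ⟨
    ¬ proj₁ (¬¬ᴿ (eval A ρ s))                   ≡⟨ cong (λ a → ¬ proj₁ a) ¬¬s≡¬¬t ⟩
    ¬ proj₁ (¬¬ᴿ (eval A ρ t))                   ≡⟨ ¬-regular ⟩
    ¬ eval A ρ t                                 ∎
    where
    ¬¬s≡¬¬t : ¬¬ᴿ (eval A ρ s) ≡ ¬¬ᴿ (eval A ρ t)
    ¬¬s≡¬¬t = trans (sym (eval-¬¬ ρ s))
                    (trans (valid regularAlgebra regularAlgebra-isBA (λ n → ¬¬ᴿ (ρ n))) (eval-¬¬ ρ t))
    open ≡-Reasoning

module BooleanAlgebraProperties (C : FLe) (isBA : BA C) where
  open FLeProperties C

  private
    ·≡∧ : ∀ x y → x · y ≡ x ∧ y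
    ·≡∧ = proj₁ isBA
    ⇒≡¬∨ : ∀ x y → x ⇒ y ≡ ¬ x ∨ y
    ⇒≡¬∨ = proj₂ isBA

  integral : Integral C
  integral x = trans (sym (·≡∧ x 𝟙)) (·-identityʳ x)

  𝟘-least : ∀ {x} → 𝟘 ≤ x
  𝟘-least {x} = subst (𝟘 ≤_) 𝟘∨x≡x x≤x∨y
    where
    𝟘∨x≡x : 𝟘 ∨ x ≡ x
    𝟘∨x≡x = trans (cong (_∨ x) (sym ¬𝟙≡𝟘)) (trans (sym (⇒≡¬∨ 𝟙 x)) 𝟙⇒x≡x)

  weakening : Weakening C
  weakening = integral , λ _ → 𝟘-least

  x∧¬x≤𝟘 : ∀ {x} → x ∧ ¬ x ≤ 𝟘
  x∧¬x≤𝟘 {x} = subst (_≤ 𝟘) (·≡∧ x (¬ x)) (·-comm-≤ modus-ponens)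

  ¬¬-involutive : ∀ {x} → Regular x
  ¬¬-involutive {x} =
    ≤-antisym (subst (_≤ x) (·-identityˡ (¬ ¬ x)) (⇒-elim 𝟙≤¬¬x⇒x)) x≤¬¬x
    where
    x⇒x≡¬¬x⇒x : x ⇒ x ≡ ¬ ¬ x ⇒ x
    x⇒x≡¬¬x⇒x = trans (⇒≡¬∨ x x) (sym (trans (⇒≡¬∨ (¬ ¬ x) x) (cong (_∨ x) ¬-regular)))
    𝟙≤¬¬x⇒x : 𝟙 ≤ ¬ ¬ x ⇒ x
    𝟙≤¬¬x⇒x =
      subst (𝟙 ≤_) x⇒x≡¬¬x⇒x (⇒-intro (subst (_≤ x) (sym (·-identityˡ x)) ≤-refl))

  ⊨¬⇒⊨ : ∀ s t → C ⊨ (¬ₜ s , ¬ₜ t) → C ⊨ (s , t)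
  ⊨¬⇒⊨ s t holds ρ = trans (sym ¬¬-involutive) (trans (cong ¬_ (holds ρ)) ¬¬-involutive)

⊨axiomEw⇒⊨axiomEi : (A : FLe) → Weakening A → A ⊨ axiomEw → A ⊨ axiomEi
⊨axiomEw⇒⊨axiomEi A (_ , 𝟘-least) holds ρ =
  ≤-trans (∧-mono ≤-refl (¬-antitone (⇒-monoʳ (𝟘-least (ρ 1))))) (holds (λ _ → ¬ ρ 0))
  where open FLeProperties A

BA⊨axiomEw : BA ⊨ᵛ axiomEw
BA⊨axiomEw C isBA ρ = x∧¬x≤𝟘
  where open BooleanAlgebraProperties C isBA

BA⊨axiomEi : BA ⊨ᵛ axiomEi
BA⊨axiomEi C isBA = ⊨axiomEw⇒⊨axiomEi C weakening (BA⊨axiomEw C isBA)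
  where open BooleanAlgebraProperties C isBA

glivenkoBA-intro : (Γ : EqSet) → (∀ C → BA C → Mod Γ C) →
                   (∀ A → Mod Γ A → Integral A × A ⊨ axiomEi) → GlivenkoBA (Mod Γ)
glivenkoBA-intro Γ BA⊆Γ sound s t = mk⇔
  (λ valid A A∈Γ → let integral , holds = sound A A∈Γ
                   in DoubleNegation.¬-preserves-BA-equations A integral holds s t valid)
  (λ holds C isBA → BooleanAlgebraProperties.⊨¬⇒⊨ C isBA s t (holds C (BA⊆Γ C isBA)))

InG⇒⊨≤𝟘 : ∀ {A} s → BA ⊨ᵛ (s ≤ₑ 0ₜ) → InG A → A ⊨ (s ≤ₑ 0ₜ)
InG⇒⊨≤𝟘 {A} s valid (Γ , glivenko , A∈Γ) ρ =
  ¬x≡¬𝟘⇒x≤𝟘 (Equivalence.to (glivenko s 0ₜ) s≡𝟘 A A∈Γ ρ)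
  where
  open FLeProperties A
  s≡𝟘 : BA ⊨ᵛ (s , 0ₜ)
  s≡𝟘 C isBA ρ = FLeProperties.≤-antisym C (valid C isBA ρ) 𝟘-least
    where open BooleanAlgebraProperties C isBA

integralEq bottomEq : Equation
integralEq = var 0 ≤ₑ 1ₜ
bottomEq   = 0ₜ ≤ₑ var 0

Mod-∈ : ∀ {A es} → All (A ⊨_) es → Mod (_∈ es) A
Mod-∈ holds _ = lookup holds

Γᵢ Γʷ : EqSet
Γᵢ = _∈ integralEq ∷ axiomEi ∷ []
Γʷ = _∈ integralEq ∷ bottomEq ∷ axiomEw ∷ []

Γᵢ-intro : ∀ A → Integral A → A ⊨ axiomEi → Mod Γᵢ A
Γᵢ-intro A integral holds = Mod-∈ ((λ ρ → integral (ρ 0)) ∷ holds ∷ [])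

Γʷ-intro : ∀ A → Weakening A → A ⊨ axiomEw → Mod Γʷ A
Γʷ-intro A (integral , 𝟘-least) holds =
  Mod-∈ ((λ ρ → integral (ρ 0)) ∷ (λ ρ → 𝟘-least (ρ 0)) ∷ holds ∷ [])

Γᵢ-glivenkoBA : GlivenkoBA (Mod Γᵢ)
Γᵢ-glivenkoBA = glivenkoBA-intro Γᵢ BA⊆Γᵢ sound
  where
  BA⊆Γᵢ : ∀ C → BA C → Mod Γᵢ C
  BA⊆Γᵢ C isBA = Γᵢ-intro C integral (BA⊨axiomEi C isBA)
    where open BooleanAlgebraProperties C isBA
  sound : ∀ A → Mod Γᵢ A → Integral A × A ⊨ axiomEi
  sound A A∈Γᵢ = (λ x → A∈Γᵢ _ (here refl) (λ _ → x)) , A∈Γᵢ _ (there (here refl))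

Γʷ-glivenkoBA : GlivenkoBA (Mod Γʷ)
Γʷ-glivenkoBA = glivenkoBA-intro Γʷ BA⊆Γʷ sound
  where
  BA⊆Γʷ : ∀ C → BA C → Mod Γʷ C
  BA⊆Γʷ C isBA = Γʷ-intro C weakening (BA⊨axiomEw C isBA)
    where open BooleanAlgebraProperties C isBA
  sound : ∀ A → Mod Γʷ A → Integral A × A ⊨ axiomEi
  sound A A∈Γʷ = integral , ⊨axiomEw⇒⊨axiomEi A (integral , 𝟘-least) axiomEw-holds
    where
    integral : Integral A
    integral x = A∈Γʷ _ (here refl) (λ _ → x)
    𝟘-least : ∀ x → FLe._≤_ A (FLe.𝟘 A) x
    𝟘-least x = A∈Γʷ _ (there (here refl)) (λ _ → x)
    axiomEw-holds : A ⊨ axiomEw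
    axiomEw-holds = A∈Γʷ _ (there (there (here refl)))

corollary2p12 : ((A : FLe) → Integral A → (InG A ⇔ (A ⊨ axiomEi)))
    × ((A : FLe) → Weakening A → (InG A ⇔ (A ⊨ axiomEw)))
corollary2p12 =
  -- An axiom s ≤ₑ 0ₜ is the pair (s ∧ₜ 0ₜ , s), so its second component is s.
  (λ A integral → mk⇔ (InG⇒⊨≤𝟘 (proj₂ axiomEi) BA⊨axiomEi)
                      (λ holds → Γᵢ , Γᵢ-glivenkoBA , Γᵢ-intro A integral holds)) ,
  (λ A weakening → mk⇔ (InG⇒⊨≤𝟘 (proj₂ axiomEw) BA⊨axiomEw)
                       (λ holds → Γʷ , Γʷ-glivenkoBA , Γʷ-intro A weakening holds))
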